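{- Let $\Gamma$ be a finite set of formulas. Then the smallest adequate set of formulas containing $\Gamma$ is finite.
   Context: Formulas: $\varphi ::= p \mid \neg\varphi \mid \varphi\wedge\varphi \mid \Box\varphi \mid \gamma(\varphi,\varphi)$, with $\to$ and $\Diamond\varphi:=\neg\Box\neg\varphi$ as abbreviations. A set $\Sigma$ of formulas is adequate if it is closed under subformulas and under single negations (if $\varphi\in\Sigma$ and $\varphi$ is not itself a negation then $\neg\varphi\in\Sigma$), and whenever $\gamma(\varphi,\psi)\in\Sigma$ then $\Box(\varphi\to\gamma(\varphi,\psi))\in\Sigma$ and $\Diamond(\varphi\wedge\gamma(\varphi,\psi))\in\Sigma$. -}

module Defs where

open import Data.Nat using (ℕ)
open import Data.Empty using (⊥)
open import Data.Unit using (⊤)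
open import Data.List using (List)
open import Data.List.Membership.Propositional using (_∈_)
open import Relation.Nullary using (¬_)
open import Data.Product using (∃)
open import Function.Bundles using (_⇔_)

data Formula : Set where
  var  : ℕ → Formula
  neg  : Formula → Formula
  conj : Formula → Formula → Formula
  box  : Formula → Formula
  gam  : Formula → Formula → Formula

_⇒_ : Formula → Formula → Formula
φ ⇒ ψ = neg (conj φ (neg ψ))

dia : Formula → Formula
dia φ = neg (box (neg φ))

IsNeg : Formula → Set
IsNeg (neg _) = ⊤
IsNeg _       = ⊥

FSet : Set₁
FSet = Formula → Set

-- subformula closure (immediate subformulas; closure under these gives all subformulas)
record Adequate (Σ : FSet) : Set where
  field
    sub-neg   : ∀ {φ} → Σ (neg φ) → Σ φ
    sub-conjˡ : ∀ {φ ψ} → Σ (conj φ ψ) → Σ φ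
    sub-conjʳ : ∀ {φ ψ} → Σ (conj φ ψ) → Σ ψ
    sub-box   : ∀ {φ} → Σ (box φ) → Σ φ
    sub-gamˡ  : ∀ {φ ψ} → Σ (gam φ ψ) → Σ φ
    sub-gamʳ  : ∀ {φ ψ} → Σ (gam φ ψ) → Σ ψ
    neg-closed : ∀ {φ} → Σ φ → ¬ IsNeg φ → Σ (neg φ)
    gam-box   : ∀ {φ ψ} → Σ (gam φ ψ) → Σ (box (φ ⇒ gam φ ψ))
    gam-dia   : ∀ {φ ψ} → Σ (gam φ ψ) → Σ (dia (conj φ (gam φ ψ)))

-- the smallest adequate set containing Γ: intersection of all adequate supersets of Γ
SmallestAdequate : List Formula → Formula → Set₁
SmallestAdequate Γ φ =
  (A : FSet) → Adequate A → (∀ {ψ} → ψ ∈ Γ → A ψ) → A φ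

IsFinite : (Formula → Set₁) → Set₁
IsFinite S = ∃ λ (L : List Formula) → ∀ φ → (S φ ⇔ (φ ∈ L))

-- Adequacy is closure under one-step requirements φ ↝ χ. Apart from the two γ-rules
-- these lead to immediate subformulas or to a single negation. For γ(φ,ψ) the γ-rules
-- produce only ten formulas built from φ and γ(φ,ψ), and the requirements of those ten
-- stay among them and the closures of φ and ψ. Hence a ↝-closed list containing a
-- formula can be computed by structural recursion, and it lies in every ↝-closed set
-- containing the formula; concatenating these lists over Γ gives the smallest adequate set.
module Submission where

open import Defs
open import Data.Empty using (⊥-elim)
open import Data.Fin using (Fin; #_)
open import Data.List using (List; []; _∷_; _++_; concatMap; lookup)
open import Data.List.Membership.Propositional using (_∈_; find; lose)
open import Data.List.Membership.Propositional.Properties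
  using (∈-++⁺ˡ; ∈-++⁺ʳ; ∈-++⁻; ∈-concatMap⁺; ∈-concatMap⁻; ∈-lookup)
open import Data.List.Relation.Unary.All as All using (All; []; _∷_)
open import Data.List.Relation.Unary.Any as Any using (here; there)
open import Data.Product using (_,_)
open import Data.Sum using (inj₁; inj₂)
open import Data.Unit using (tt)
open import Function.Bundles using (mk⇔)
open import Relation.Binary.Core using (Rel)
open import Relation.Binary.Definitions using (_Respects_)
open import Relation.Binary.PropositionalEquality using (refl)
open import Relation.Nullary using (¬_)

module _ {a r} {A : Set a} {R : Rel A r} where

  ++-respects : ∀ {xs ys} → (_∈ xs) Respects R → (_∈ ys) Respects R →
                (_∈ xs ++ ys) Respects R
  ++-respects {xs} resp-xs resp-ys step p with ∈-++⁻ xs p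
  ... | inj₁ p-xs = ∈-++⁺ˡ (resp-xs step p-xs)
  ... | inj₂ p-ys = ∈-++⁺ʳ xs (resp-ys step p-ys)

  concatMap-respects : (f : A → List A) → (∀ x → (_∈ f x) Respects R) →
                       ∀ xs → (_∈ concatMap f xs) Respects R
  concatMap-respects f resp xs step p =
    ∈-concatMap⁺ f {xs = xs} (Any.map (λ {x} → resp x step) (∈-concatMap⁻ f p))

infix 4 _↝_

data _↝_ : Formula → Formula → Set where
  sub-neg    : ∀ {φ} → neg φ ↝ φ
  sub-conjˡ  : ∀ {φ ψ} → conj φ ψ ↝ φ
  sub-conjʳ  : ∀ {φ ψ} → conj φ ψ ↝ ψ
  sub-box    : ∀ {φ} → box φ ↝ φ
  sub-gamˡ   : ∀ {φ ψ} → gam φ ψ ↝ φ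
  sub-gamʳ   : ∀ {φ ψ} → gam φ ψ ↝ ψ
  neg-closed : ∀ {φ} → ¬ IsNeg φ → φ ↝ neg φ
  gam-box    : ∀ {φ ψ} → gam φ ψ ↝ box (φ ⇒ gam φ ψ)
  gam-dia    : ∀ {φ ψ} → gam φ ψ ↝ dia (conj φ (gam φ ψ))

adequate⇒respects : ∀ {S} → Adequate S → S Respects _↝_
adequate⇒respects ad sub-neg            = Adequate.sub-neg ad
adequate⇒respects ad sub-conjˡ          = Adequate.sub-conjˡ ad
adequate⇒respects ad sub-conjʳ          = Adequate.sub-conjʳ ad
adequate⇒respects ad sub-box            = Adequate.sub-box ad
adequate⇒respects ad sub-gamˡ           = Adequate.sub-gamˡ ad
adequate⇒respects ad sub-gamʳ           = Adequate.sub-gamʳ ad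
adequate⇒respects ad (neg-closed ¬neg) s = Adequate.neg-closed ad s ¬neg
adequate⇒respects ad gam-box            = Adequate.gam-box ad
adequate⇒respects ad gam-dia            = Adequate.gam-dia ad

respects⇒adequate : ∀ {S} → S Respects _↝_ → Adequate S
respects⇒adequate resp = record
  { sub-neg    = resp sub-neg
  ; sub-conjˡ  = resp sub-conjˡ
  ; sub-conjʳ  = resp sub-conjʳ
  ; sub-box    = resp sub-box
  ; sub-gamˡ   = resp sub-gamˡ
  ; sub-gamʳ   = resp sub-gamʳ
  ; neg-closed = λ s ¬neg → resp (neg-closed ¬neg) s
  ; gam-box    = resp gam-box
  ; gam-dia    = resp gam-dia
  }

γ-expansion : Formula → Formula → List Formula
γ-expansion φ ψ =
  G ∷ neg G ∷
  box (φ ⇒ G) ∷ neg (box (φ ⇒ G)) ∷ (φ ⇒ G) ∷ conj φ (neg G) ∷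
  dia (conj φ G) ∷ box (neg (conj φ G)) ∷ neg (conj φ G) ∷ conj φ G ∷ []
  where G = gam φ ψ

closure : Formula → List Formula
closure (var n)    = var n ∷ neg (var n) ∷ []
closure (neg φ)    = neg φ ∷ closure φ
closure (conj φ ψ) = conj φ ψ ∷ neg (conj φ ψ) ∷ closure φ ++ closure ψ
closure (box φ)    = box φ ∷ neg (box φ) ∷ closure φ
closure (gam φ ψ)  = γ-expansion φ ψ ++ closure φ ++ closure ψ

closure-self : ∀ θ → θ ∈ closure θ
closure-self (var n)    = here refl
closure-self (neg φ)    = here refl
closure-self (conj φ ψ) = here refl
closure-self (box φ)    = here refl
closure-self (gam φ ψ)  = here refl

γ-expansion-closed : ∀ φ ψ →
  All (λ χ → ∀ {χ'} → χ ↝ χ' → χ' ∈ closure (gam φ ψ)) (γ-expansion φ ψ)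
γ-expansion-closed φ ψ
  = (λ { (neg-closed _) → at (# 1) ; sub-gamˡ → φ∈ ; sub-gamʳ → ψ∈
       ; gam-box → at (# 2) ; gam-dia → at (# 6) })
  ∷ (λ { sub-neg → at (# 0) ; (neg-closed ¬neg) → ⊥-elim (¬neg tt) })
  ∷ (λ { sub-box → at (# 4) ; (neg-closed _) → at (# 3) })
  ∷ (λ { sub-neg → at (# 2) ; (neg-closed ¬neg) → ⊥-elim (¬neg tt) })
  ∷ (λ { sub-neg → at (# 5) ; (neg-closed ¬neg) → ⊥-elim (¬neg tt) })
  ∷ (λ { sub-conjˡ → φ∈ ; sub-conjʳ → at (# 1) ; (neg-closed _) → at (# 4) })
  ∷ (λ { sub-neg → at (# 7) ; (neg-closed ¬neg) → ⊥-elim (¬neg tt) })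
  ∷ (λ { sub-box → at (# 8) ; (neg-closed _) → at (# 6) })
  ∷ (λ { sub-neg → at (# 9) ; (neg-closed ¬neg) → ⊥-elim (¬neg tt) })
  ∷ (λ { sub-conjˡ → φ∈ ; sub-conjʳ → at (# 0) ; (neg-closed _) → at (# 8) })
  ∷ []
  where
  at : (i : Fin 10) → lookup (γ-expansion φ ψ) i ∈ closure (gam φ ψ)
  at i = ∈-++⁺ˡ (∈-lookup {xs = γ-expansion φ ψ} i)
  φ∈ : φ ∈ closure (gam φ ψ)
  φ∈ = ∈-++⁺ʳ (γ-expansion φ ψ) (∈-++⁺ˡ (closure-self φ))
  ψ∈ : ψ ∈ closure (gam φ ψ)
  ψ∈ = ∈-++⁺ʳ (γ-expansion φ ψ) (∈-++⁺ʳ (closure φ) (closure-self ψ))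

γ-expansion-minimal : ∀ {S : FSet} → S Respects _↝_ →
                      ∀ {φ ψ} → S (gam φ ψ) → All S (γ-expansion φ ψ)
γ-expansion-minimal {S} resp {φ} {ψ} s
  = s ∷ resp (neg-closed λ ()) s
  ∷ s-box ∷ resp (neg-closed λ ()) s-box ∷ s-imp ∷ resp sub-neg s-imp
  ∷ s-dia ∷ s-box-neg ∷ resp sub-box s-box-neg ∷ resp sub-neg (resp sub-box s-box-neg)
  ∷ []
  where
  s-box : S (box (φ ⇒ gam φ ψ))
  s-box = resp gam-box s
  s-imp : S (φ ⇒ gam φ ψ)
  s-imp = resp sub-box s-box
  s-dia : S (dia (conj φ (gam φ ψ)))
  s-dia = resp gam-dia s
  s-box-neg : S (box (neg (conj φ (gam φ ψ))))
  s-box-neg = resp sub-neg s-dia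

closure-closed : ∀ θ → (_∈ closure θ) Respects _↝_
closure-closed (var n) (neg-closed _) (here refl)             = there (here refl)
closure-closed (var n) sub-neg (there (here refl))            = here refl
closure-closed (var n) (neg-closed ¬neg) (there (here refl))  = ⊥-elim (¬neg tt)
closure-closed (neg φ) sub-neg (here refl)                    = there (closure-self φ)
closure-closed (neg φ) (neg-closed ¬neg) (here refl)          = ⊥-elim (¬neg tt)
closure-closed (neg φ) step (there p)                         = there (closure-closed φ step p)
closure-closed (conj φ ψ) sub-conjˡ (here refl)               =
  there (there (∈-++⁺ˡ (closure-self φ)))
closure-closed (conj φ ψ) sub-conjʳ (here refl)               =
  there (there (∈-++⁺ʳ (closure φ) (closure-self ψ)))
closure-closed (conj φ ψ) (neg-closed _) (here refl)          = there (here refl)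
closure-closed (conj φ ψ) sub-neg (there (here refl))         = here refl
closure-closed (conj φ ψ) (neg-closed ¬neg) (there (here refl)) = ⊥-elim (¬neg tt)
closure-closed (conj φ ψ) step (there (there p))              =
  there (there (++-respects (closure-closed φ) (closure-closed ψ) step p))
closure-closed (box φ) sub-box (here refl)                    = there (there (closure-self φ))
closure-closed (box φ) (neg-closed _) (here refl)             = there (here refl)
closure-closed (box φ) sub-neg (there (here refl))            = here refl
closure-closed (box φ) (neg-closed ¬neg) (there (here refl))  = ⊥-elim (¬neg tt)
closure-closed (box φ) step (there (there p))                 = there (there (closure-closed φ step p))
closure-closed (gam φ ψ) step p with ∈-++⁻ (γ-expansion φ ψ) p
... | inj₁ p-γ    = All.lookup (γ-expansion-closed φ ψ) p-γ step
... | inj₂ p-rest =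
  ∈-++⁺ʳ (γ-expansion φ ψ) (++-respects (closure-closed φ) (closure-closed ψ) step p-rest)

closure-minimal : ∀ {S : FSet} → S Respects _↝_ → ∀ {θ} → S θ → ∀ {χ} → χ ∈ closure θ → S χ
closure-minimal resp {var n} s (here refl)                   = s
closure-minimal resp {var n} s (there (here refl))           = resp (neg-closed λ ()) s
closure-minimal resp {neg φ} s (here refl)                   = s
closure-minimal resp {neg φ} s (there p)                     = closure-minimal resp (resp sub-neg s) p
closure-minimal resp {conj φ ψ} s (here refl)                = s
closure-minimal resp {conj φ ψ} s (there (here refl))        = resp (neg-closed λ ()) s
closure-minimal resp {conj φ ψ} s (there (there p)) with ∈-++⁻ (closure φ) p
... | inj₁ p-φ = closure-minimal resp (resp sub-conjˡ s) p-φ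
... | inj₂ p-ψ = closure-minimal resp (resp sub-conjʳ s) p-ψ
closure-minimal resp {box φ} s (here refl)                   = s
closure-minimal resp {box φ} s (there (here refl))           = resp (neg-closed λ ()) s
closure-minimal resp {box φ} s (there (there p))             = closure-minimal resp (resp sub-box s) p
closure-minimal resp {gam φ ψ} s p with ∈-++⁻ (γ-expansion φ ψ) p
... | inj₁ p-γ = All.lookup (γ-expansion-minimal resp s) p-γ
... | inj₂ p-rest with ∈-++⁻ (closure φ) p-rest
...   | inj₁ p-φ = closure-minimal resp (resp sub-gamˡ s) p-φ
...   | inj₂ p-ψ = closure-minimal resp (resp sub-gamʳ s) p-ψ

closureList : List Formula → List Formula
closureList = concatMap closure

smallestAdequate⇒∈closureList : ∀ Γ {φ} → SmallestAdequate Γ φ → φ ∈ closureList Γ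
smallestAdequate⇒∈closureList Γ smallest =
  smallest (_∈ closureList Γ)
           (respects⇒adequate (concatMap-respects closure closure-closed Γ))
           (λ θ∈Γ → ∈-concatMap⁺ closure (lose θ∈Γ (closure-self _)))

∈closureList⇒smallestAdequate : ∀ Γ {φ} → φ ∈ closureList Γ → SmallestAdequate Γ φ
∈closureList⇒smallestAdequate Γ p S adequate Γ⊆S =
  let θ , θ∈Γ , p-θ = find (∈-concatMap⁻ closure {xs = Γ} p)
  in closure-minimal (adequate⇒respects adequate) (Γ⊆S θ∈Γ) p-θ

mainTheorem11 : (Γ : List Formula) → IsFinite (SmallestAdequate Γ)
mainTheorem11 Γ =
  closureList Γ ,
  λ φ → mk⇔ (smallestAdequate⇒∈closureList Γ) (∈closureList⇒smallestAdequate Γ)
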